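{- Let $n\ge 1$, with the convention $\mathrm{TH}_2=\mathrm{PF}_1(1)=\emptyset$. Then the set $\mathrm{TH}_{n+1}$ of ideal states of the $(n+1)\times(n+1)$ Tower of Hanoi game and the set $\mathrm{PF}_n(1)$ of parking functions of length $n$ with displacement one are in bijection. Moreover, both sets are enumerated by the Lah numbers (OEIS A001286), i.e. $|\mathrm{TH}_{n+1}|=|\mathrm{PF}_n(1)|=\frac{n!\,(n-1)}{2}$.
   Context: Parking functions: for $n\in\mathbb{N}$, $n$ cars numbered $1,\dots,n$ enter in order a one-way street with spots $1,\dots,n$. Given a preference vector $\alpha=(a_1,\dots,a_n)\in[n]^n$ (where $[n]=\{1,\dots,n\}$), car $i$ drives to spot $a_i$ and parks there if it is free; otherwise it parks in the first free spot after $a_i$ (if none exists, it fails to park). $\alpha$ is a parking function of length $n$ if all cars park. If car $i$ parks in spot $p_i$, its displacement is $k_i=p_i-a_i$, and the displacement of $\alpha$ is $d(\alpha)=\sum_{i=1}^n k_i$. $\mathrm{PF}_n(1)$ is the set of parking functions of length $n$ with $d(\alpha)=1$. Tower of Hanoi: for $n\ge 2$, the $(n+1)\times(n+1)$ game has disks labeled $0,\dots,n$ by increasing size and pegs labeled $0,\dots,n$; on each peg disks are stacked with smaller disks above larger ones. An ideal state is an arrangement of all $n+1$ disks on the pegs such that: disk $n$ is alone on peg $0$; peg $n$ is the only empty peg; and the remaining $n$ disks lie on the interior pegs $1,\dots,n-1$ so that each interior peg has at least one disk (hence exactly one interior peg has two disks). $\mathrm{TH}_{n+1}$ denotes the set of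 distinct ideal states. -}

module Defs where

open import Data.Nat using (ℕ; zero; suc; _+_; _∸_; _<ᵇ_; _≡ᵇ_)
open import Data.Nat.Properties using (_≟_)
open import Data.Bool using (Bool; true; false; if_then_else_; _∧_; not; _∨_)
open import Data.Fin using (Fin; toℕ; fromℕ) renaming (zero to fzero)
open import Data.Fin.Properties using () renaming (_≟_ to _≟ᶠ_)
open import Data.Vec using (Vec; lookup; toList; allFin)
open import Data.List using (List; []; _∷_; length; filter)
open import Data.List.Membership.DecPropositional _≟_ using (_∈?_)
open import Data.Maybe using (Maybe; just; nothing; map)
open import Data.Product using (Σ; _×_)
open import Relation.Nullary.Decidable using (does)
open import Relation.Binary.PropositionalEquality using (_≡_)

-- Parking functions.
-- Spots and preferences are 0-indexed: spot j ∈ Fin n stands for spot j+1,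
-- preference a ∈ Fin n stands for preference toℕ a + 1.

firstFree : List ℕ → ℕ → ℕ → Maybe ℕ
firstFree occ s zero    = nothing
firstFree occ s (suc k) = if does (s ∈? occ) then firstFree occ (suc s) k else just s

runParking : ℕ → List ℕ → List ℕ → Maybe ℕ
runParking n occ []       = just 0
runParking n occ (a ∷ as) with firstFree occ a (n ∸ a)
... | nothing = nothing
... | just p  = map ((p ∸ a) +_) (runParking n (p ∷ occ) as)

parkingOutcome : {n : ℕ} → Vec (Fin n) n → Maybe ℕ
parkingOutcome {n} α = runParking n [] (Data.List.map toℕ (toList α))

-- α is a parking function with displacement d(α) = 1
-- (parkingOutcome α ≡ just d  iff all cars park and d(α) = d)
PF : ℕ → Set
PF n = Σ (Vec (Fin n) n) (λ α → parkingOutcome α ≡ just 1)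

-- Tower of Hanoi, (n+1)×(n+1) game: disks 0..n, pegs 0..n.
-- A state assigns each disk its peg (the order on a peg is forced by size).
HanoiState : ℕ → Set
HanoiState n = Vec (Fin (suc n)) (suc n)

diskCount : {n : ℕ} → HanoiState n → Fin (suc n) → ℕ
diskCount s p = length (filter (λ q → q ≟ᶠ p) (toList s))

allᵇ : {A : Set} → (A → Bool) → List A → Bool
allᵇ f []       = true
allᵇ f (x ∷ xs) = f x ∧ allᵇ f xs

isInterior : {n : ℕ} → Fin (suc n) → Bool
isInterior {n} p = (0 <ᵇ toℕ p) ∧ (toℕ p <ᵇ n)

-- ideal state:
--  * disk n is on peg 0 and alone there,
--  * peg n is empty,
--  * every interior peg carries at least one disk.
-- (Hence the other disks lie on interior pegs and peg n is the only empty peg.)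
IsIdeal : (n : ℕ) → HanoiState n → Set
IsIdeal n s =
  (lookup s (fromℕ n) ≡ fzero) ×
  (diskCount s fzero ≡ 1) ×
  (diskCount s (fromℕ n) ≡ 0) ×
  (allᵇ (λ p → not (isInterior p) ∨ (0 <ᵇ diskCount s p)) (toList (allFin (suc n))) ≡ true)

-- TH n  is the set TH_{n+1} of ideal states of the (n+1)×(n+1) game
TH : ℕ → Set
TH n = Σ (HanoiState n) (IsIdeal n)

-- Both sets are in bijection with the vectors of length n over Fin (n ∸ 1) that take every
-- value (surjections from n points onto n - 1 points). An ideal state is determined by the pegs
-- of the disks 0, …, n - 1, which have to cover exactly the n - 1 interior pegs. A preference
-- vector has displacement one iff some spot w is preferred twice, spot w + 1 by no car and every
-- other spot at most once; deleting the unused value w + 1 yields a surjection in which w is the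
-- only repeated value, so w, and with it the inverse map, is recovered from the surjection.
-- Splitting on whether the first value of a surjection recurs gives the recursion
-- S(k+1, L+1) = (k+1) (S(k+1, L) + S(k, L)), whence S(k, k) = k! and 2 S(k, k+1) = (k+1)! k.

module Submission where

open import Defs

open import Axiom.UniquenessOfIdentityProofs using (module Decidable⇒UIP)
open import Data.Bool using (Bool; true; false; if_then_else_; _∨_; not)
open import Data.Bool.Instances
open import Data.Bool.Properties using (T-≡)
open import Data.Empty using (⊥-elim)
open import Data.Fin using (Fin; toℕ; fromℕ; fromℕ<; inject₁; punchIn; punchOut)
  renaming (zero to fzero; suc to fsuc)
open import Data.Fin.Instances
open import Data.Fin.Properties
  using (+↔⊎; *↔×; any?; punchIn-injective; punchInᵢ≢i; punchIn-punchOut; toℕ-injective; toℕ<n;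
         toℕ-fromℕ<; toℕ-inject₁; inject₁-injective; toℕ-fromℕ)
import Data.List
open import Data.List using (List; []; _∷_; length; filter)
open import Data.List.Membership.Propositional using (_∈_)
open import Data.List.Relation.Unary.All using (All; []; _∷_)
open import Data.List.Relation.Unary.Any using (here; there)
import Data.Maybe
open import Data.Maybe using (just; nothing)
open import Data.Maybe.Properties using (just-injective) renaming (≡-dec to ≡-decᵐ)
open import Data.Nat using (ℕ; zero; suc; _+_; _*_; _∸_; _/_; _≤_; _<_; _<ᵇ_; z≤n; s≤s; _!)
open import Data.Nat.DivMod using (m*n/n≡m)
open import Data.Nat.Instances
open import Data.Nat.Properties
  using (≤-refl; ≤-trans; ≤-antisym; ≤-reflexive; ≤-pred; ≤-<-connex; <⇒≤; <⇒≱; ≰⇒>; ≮⇒≥; _≤?_; _<?_;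
         n≤1+n; n<1+n; m<n⇒m<1+n; m≤m+n; m≤n+m; 1+n≰n; 1+n≢n; 0≢1+n; n≢0⇒n>0; n≤0⇒n≡0;
         <ᵇ⇒<; <⇒<ᵇ; suc-injective; +-comm; +-assoc; +-suc; +-identityʳ; +-cancelˡ-≡; +-cancelʳ-≡;
         +-mono-≤; +-mono-<-≤; m+n≡0⇒m≡0; m+n≡0⇒n≡0; *-zeroʳ; *-assoc; *-distribʳ-+;
         n∸n≡0; m+[n∸m]≡n; +-∸-assoc; m≤n⇒m∸n≡0; m+n∸n≡m; +-0-commutativeMonoid)
open import Algebra.Properties.CommutativeMonoid.Sum +-0-commutativeMonoid
  using (sum; sum-remove; sum-cong-≗; sum-replicate-zero; ∑-distrib-+)
open import Data.List.Membership.DecPropositional Data.Nat.Properties._≟_ using (_∈?_)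
open import Data.Nat.Tactic.RingSolver using (solve-∀)
open import Data.Product using (Σ; ∃; ∃-syntax; _×_; _,_; proj₁; proj₂)
open import Data.Product.Function.NonDependent.Propositional using (_×-↔_)
open import Data.Sum using (_⊎_; inj₁; inj₂; [_,_]′)
open import Data.Sum.Function.Propositional using (_⊎-↔_)
open import Data.Vec using (Vec; []; _∷_; map; toList; allFin; tabulate; lookup; _∷ʳ_; init; last; initLast)
open import Data.Vec.Properties using (∷-injective; toList-map; map-∘; init-∷ʳ)
open import Function using (_∘_)
open import Function.Bundles using (_↔_; mk↔ₛ′; Equivalence)
open import Function.Definitions using (Injective)
open import Function.Properties.Inverse using (↔-trans; ↔-sym; ↔-refl)
open import Relation.Binary.Definitions using (Irrelevant)
open import Relation.Binary.PropositionalEquality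
  using (_≡_; _≢_; refl; sym; trans; cong; cong₂; subst; module ≡-Reasoning)
open import Relation.Binary.Structures using (IsDecEquivalence)
open import Relation.Binary.TypeClasses using (_≟_)
open import Relation.Nullary using (Dec; yes; no; does)

private
  variable
    A : Set
    k L : ℕ

map-injective : {B : Set} {f : A → B} → Injective _≡_ _≡_ f → Injective _≡_ _≡_ (map {n = L} f)
map-injective f-inj {[]}    {[]}    _  = refl
map-injective f-inj {x ∷ u} {y ∷ v} eq =
  cong₂ _∷_ (f-inj (proj₁ (∷-injective eq))) (map-injective f-inj (proj₂ (∷-injective eq)))

init-∷ʳ-last : (s : Vec A (suc L)) → init s ∷ʳ last s ≡ s
init-∷ʳ-last s = sym (proj₂ (proj₂ (initLast s)))

lookup-∷ʳ-fromℕ : (w : Vec A L) (x : A) → lookup (w ∷ʳ x) (fromℕ L) ≡ x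
lookup-∷ʳ-fromℕ []      x = refl
lookup-∷ʳ-fromℕ (y ∷ w) x = lookup-∷ʳ-fromℕ w x

lookup-fromℕ : (s : Vec A (suc L)) → lookup s (fromℕ L) ≡ last s
lookup-fromℕ s = trans (cong (λ t → lookup t (fromℕ _)) (sym (init-∷ʳ-last s))) (lookup-∷ʳ-fromℕ (init s) (last s))

Σ-≡-irrelevant : {P : A → Set} → (∀ {a} (p q : P a) → p ≡ q) → {x y : Σ A P} → proj₁ x ≡ proj₁ y → x ≡ y
Σ-≡-irrelevant irr {a , p} {.a , q} refl = cong (a ,_) (irr p q)

subset-↔ : {B : Set} {P : A → Set} {Q : B → Set} →
  (∀ {a} (p q : P a) → p ≡ q) → (∀ {b} (p q : Q b) → p ≡ q) →
  (to : Σ A P → Σ B Q) (from : Σ B Q → Σ A P) →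
  (∀ y → proj₁ (to (from y)) ≡ proj₁ y) → (∀ x → proj₁ (from (to x)) ≡ proj₁ x) → Σ A P ↔ Σ B Q
subset-↔ P-irr Q-irr to from to∘from from∘to =
  mk↔ₛ′ to from (Σ-≡-irrelevant Q-irr ∘ to∘from) (Σ-≡-irrelevant P-irr ∘ from∘to)

module _ {{_ : IsDecEquivalence {A = A} _≡_}} where

  δ : A → A → ℕ
  δ x y = if does (x ≟ y) then 1 else 0

  δ-refl : ∀ x → δ x x ≡ 1
  δ-refl x with x ≟ x
  ... | yes _  = refl
  ... | no x≢x = ⊥-elim (x≢x refl)

  δ-≢ : ∀ {x y} → x ≢ y → δ x y ≡ 0
  δ-≢ {x} {y} x≢y with x ≟ y
  ... | yes x≡y = ⊥-elim (x≢y x≡y)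
  ... | no _    = refl

  δ≡0⇒≢ : ∀ {x y} → δ x y ≡ 0 → x ≢ y
  δ≡0⇒≢ {x} δ≡0 refl with () ← trans (sym (δ-refl x)) δ≡0

  ≡-irrelevant : Irrelevant (_≡_ {A = A})
  ≡-irrelevant = Decidable⇒UIP.≡-irrelevant _≟_

  mult : List A → A → ℕ
  mult []       y = 0
  mult (x ∷ xs) y = δ x y + mult xs y

  multᵛ : {L : ℕ} → Vec A L → A → ℕ
  multᵛ v = mult (toList v)

  multᵛ-∷≡0 : ∀ x (v : Vec A L) y → multᵛ (x ∷ v) y ≡ 0 → x ≢ y × multᵛ v y ≡ 0
  multᵛ-∷≡0 x v y h = δ≡0⇒≢ (m+n≡0⇒m≡0 (δ x y) h) , m+n≡0⇒n≡0 (δ x y) h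

  ∈⇒0<mult : ∀ {s : A} xs → s ∈ xs → 0 < mult xs s
  ∈⇒0<mult {s} (x ∷ xs) (here refl) rewrite δ-refl s = s≤s z≤n
  ∈⇒0<mult {s} (x ∷ xs) (there s∈xs) = ≤-trans (∈⇒0<mult xs s∈xs) (m≤n+m (mult xs s) (δ x s))

  0<mult⇒∈ : ∀ {s : A} xs → 0 < mult xs s → s ∈ xs
  0<mult⇒∈ {s} (x ∷ xs) pos with x ≟ s
  ... | yes x≡s = here (sym x≡s)
  ... | no _    = there (0<mult⇒∈ xs pos)

module _ {B : Set} {{_ : IsDecEquivalence {A = A} _≡_}} {{_ : IsDecEquivalence {A = B} _≡_}} where

  mult-map-injective : {f : A → B} → Injective _≡_ _≡_ f →
    (xs : List A) (y : A) → mult (Data.List.map f xs) (f y) ≡ mult xs y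
  mult-map-injective f-inj []       y = refl
  mult-map-injective {f = f} f-inj (x ∷ xs) y = cong₂ _+_ δ-map (mult-map-injective f-inj xs y)
    where
    δ-map : δ (f x) (f y) ≡ δ x y
    δ-map with x ≟ y
    ... | yes refl = δ-refl (f x)
    ... | no x≢y   = δ-≢ (x≢y ∘ f-inj)

  mult-map-∉ : {f : A → B} {z : B} → (∀ x → f x ≢ z) → (xs : List A) → mult (Data.List.map f xs) z ≡ 0
  mult-map-∉ f≢z []       = refl
  mult-map-∉ f≢z (x ∷ xs) rewrite δ-≢ (f≢z x) = mult-map-∉ f≢z xs

  multᵛ-map-injective : {f : A → B} → Injective _≡_ _≡_ f →
    (v : Vec A L) (y : A) → multᵛ (map f v) (f y) ≡ multᵛ v y
  multᵛ-map-injective {f = f} f-inj v y =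
    trans (cong (λ xs → mult xs (f y)) (toList-map f v)) (mult-map-injective f-inj (toList v) y)

  multᵛ-map-∉ : {f : A → B} {z : B} → (∀ x → f x ≢ z) → (v : Vec A L) → multᵛ (map f v) z ≡ 0
  multᵛ-map-∉ {f = f} {z} f≢z v = trans (cong (λ xs → mult xs z) (toList-map f v)) (mult-map-∉ f≢z (toList v))

module _ {{_ : IsDecEquivalence {A = A} _≡_}} where

  multᵛ-∷ʳ : (w : Vec A L) (x y : A) → multᵛ (w ∷ʳ x) y ≡ multᵛ w y + δ x y
  multᵛ-∷ʳ []      x y = +-identityʳ (δ x y)
  multᵛ-∷ʳ (z ∷ w) x y = trans (cong (δ z y +_) (multᵛ-∷ʳ w x y)) (sym (+-assoc (δ z y) (multᵛ w y) (δ x y)))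

  multᵛ-init-last : (s : Vec A (suc L)) (y : A) → multᵛ s y ≡ multᵛ (init s) y + δ (last s) y
  multᵛ-init-last s y = trans (cong (λ t → multᵛ t y) (sym (init-∷ʳ-last s))) (multᵛ-∷ʳ (init s) (last s) y)

length-filter-≟ : {m : ℕ} (v : Vec (Fin m) L) (p : Fin m) → length (filter (_≟ p) (toList v)) ≡ multᵛ v p
length-filter-≟ []      p = refl
length-filter-≟ (x ∷ v) p with x ≟ p
... | yes _ = cong suc (length-filter-≟ v p)
... | no _  = length-filter-≟ v p

sum-ones : ∀ k → sum {k} (λ _ → 1) ≡ k
sum-ones zero    = refl
sum-ones (suc k) = cong suc (sum-ones k)

sum-δ : (w : Fin k) → sum (δ w) ≡ 1
sum-δ {suc k} w = begin
  sum (δ w)                            ≡⟨ sum-remove (δ w) ⟩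
  δ w w + sum (δ w ∘ punchIn w)        ≡⟨ cong₂ _+_ (δ-refl w) (sum-cong-≗ (λ j → δ-≢ (punchInᵢ≢i w j ∘ sym))) ⟩
  1 + sum {k} (λ _ → 0)                ≡⟨ cong suc (sum-replicate-zero k) ⟩
  1                                    ∎
  where open ≡-Reasoning

sum-multᵛ : (v : Vec (Fin k) L) → sum (multᵛ v) ≡ L
sum-multᵛ {k} []      = sum-replicate-zero k
sum-multᵛ     (x ∷ v) = trans (∑-distrib-+ (δ x) (multᵛ v)) (cong₂ _+_ (sum-δ x) (sum-multᵛ v))

sum-mono-≤ : (c d : Fin k → ℕ) → (∀ j → c j ≤ d j) → sum c ≤ sum d
sum-mono-≤ {zero}  c d c≤d = z≤n
sum-mono-≤ {suc k} c d c≤d = +-mono-≤ (c≤d fzero) (sum-mono-≤ (c ∘ fsuc) (d ∘ fsuc) (c≤d ∘ fsuc))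

+-≤-≡⇒≡ : ∀ {a b x y} → a ≤ b → x ≤ y → a + x ≡ b + y → a ≡ b × x ≡ y
+-≤-≡⇒≡ {a} {b} {x} {y} a≤b x≤y eq with ≤-<-connex b a
... | inj₁ b≤a = a≡b , +-cancelˡ-≡ a x y (trans eq (cong (_+ y) (sym a≡b)))
  where a≡b = ≤-antisym a≤b b≤a
... | inj₂ a<b = ⊥-elim (<⇒≱ (+-mono-<-≤ a<b x≤y) (≤-reflexive (sym eq)))

≤-sum-≡⇒≗ : (c d : Fin k → ℕ) → (∀ j → c j ≤ d j) → sum c ≡ sum d → ∀ j → c j ≡ d j
≤-sum-≡⇒≗ {suc k} c d c≤d eq fzero    = proj₁ (+-≤-≡⇒≡ (c≤d fzero) (sum-mono-≤ _ _ (c≤d ∘ fsuc)) eq)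
≤-sum-≡⇒≗ {suc k} c d c≤d eq (fsuc j) =
  ≤-sum-≡⇒≗ (c ∘ fsuc) (d ∘ fsuc) (c≤d ∘ fsuc) (proj₂ (+-≤-≡⇒≡ (c≤d fzero) (sum-mono-≤ _ _ (c≤d ∘ fsuc)) eq)) j

<ᵇ≡true⇒< : ∀ m n → (m <ᵇ n) ≡ true → m < n
<ᵇ≡true⇒< m n = <ᵇ⇒< m n ∘ Equivalence.from T-≡

<⇒<ᵇ≡true : ∀ {m n} → m < n → (m <ᵇ n) ≡ true
<⇒<ᵇ≡true = Equivalence.to T-≡ ∘ <⇒<ᵇ

allᵇ-tabulate⁻ : {n : ℕ} (f : A → Bool) (h : Fin n → A) →
  allᵇ f (toList (tabulate h)) ≡ true → ∀ i → f (h i) ≡ true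
allᵇ-tabulate⁻ {n = suc n} f h all i with f (h fzero) in eq
allᵇ-tabulate⁻ {n = suc n} f h all fzero    | true = eq
allᵇ-tabulate⁻ {n = suc n} f h all (fsuc i) | true = allᵇ-tabulate⁻ f (h ∘ fsuc) all i

allᵇ-tabulate⁺ : {n : ℕ} (f : A → Bool) (h : Fin n → A) →
  (∀ i → f (h i) ≡ true) → allᵇ f (toList (tabulate h)) ≡ true
allᵇ-tabulate⁺ {n = zero}  f h all = refl
allᵇ-tabulate⁺ {n = suc n} f h all rewrite all fzero = allᵇ-tabulate⁺ f (h ∘ fsuc) (all ∘ fsuc)

Covers : Vec (Fin k) L → Set
Covers {k} v = (j : Fin k) → 0 < multᵛ v j

-- A boolean test rather than Covers, so that its proofs are unique.
IsOnto : Vec (Fin k) L → Set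
IsOnto {k} v = allᵇ (λ j → 0 <ᵇ multᵛ v j) (toList (allFin k)) ≡ true

onto⁻ : (v : Vec (Fin k) L) → IsOnto v → Covers v
onto⁻ v o j = <ᵇ≡true⇒< 0 (multᵛ v j) (allᵇ-tabulate⁻ _ _ o j)

onto⁺ : (v : Vec (Fin k) L) → Covers v → IsOnto v
onto⁺ v cov = allᵇ-tabulate⁺ _ _ (<⇒<ᵇ≡true ∘ cov)

Onto : ℕ → ℕ → Set
Onto k L = Σ (Vec (Fin k) L) IsOnto

Onto-≡ : {u v : Vec (Fin k) L} {o : IsOnto u} {o′ : IsOnto v} → u ≡ v → (u , o) ≡ (v , o′)
Onto-≡ = Σ-≡-irrelevant ≡-irrelevant

punchOutᵛ : (x : Fin (suc k)) (v : Vec (Fin (suc k)) L) → multᵛ v x ≡ 0 → Vec (Fin k) L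
punchOutᵛ x []      _ = []
punchOutᵛ x (y ∷ v) h = punchOut (y≢x ∘ sym) ∷ punchOutᵛ x v h′
  where
  y≢x = proj₁ (multᵛ-∷≡0 y v x h)
  h′  = proj₂ (multᵛ-∷≡0 y v x h)

map-punchIn-punchOutᵛ : (x : Fin (suc k)) (v : Vec (Fin (suc k)) L) (h : multᵛ v x ≡ 0) →
  map (punchIn x) (punchOutᵛ x v h) ≡ v
map-punchIn-punchOutᵛ x []      h = refl
map-punchIn-punchOutᵛ x (y ∷ v) h = cong₂ _∷_ (punchIn-punchOut _) (map-punchIn-punchOutᵛ x v _)

punchOutᵛ-unique : (x : Fin (suc k)) {u : Vec (Fin k) L} {v : Vec (Fin (suc k)) L} (h : multᵛ v x ≡ 0) →
  map (punchIn x) u ≡ v → punchOutᵛ x v h ≡ u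
punchOutᵛ-unique x {v = v} h eq =
  map-injective (punchIn-injective x _ _) (trans (map-punchIn-punchOutᵛ x v h) (sym eq))

multᵛ-punchOutᵛ : (x : Fin (suc k)) (v : Vec (Fin (suc k)) L) (h : multᵛ v x ≡ 0) (j : Fin k) →
  multᵛ (punchOutᵛ x v h) j ≡ multᵛ v (punchIn x j)
multᵛ-punchOutᵛ x v h j = begin
  multᵛ (punchOutᵛ x v h) j                           ≡⟨ multᵛ-map-injective (punchIn-injective x _ _) (punchOutᵛ x v h) j ⟨
  multᵛ (map (punchIn x) (punchOutᵛ x v h)) (punchIn x j) ≡⟨ cong (λ u → multᵛ u (punchIn x j)) (map-punchIn-punchOutᵛ x v h) ⟩
  multᵛ v (punchIn x j)                               ∎
  where open ≡-Reasoning

multᵛ-map-punchIn-self : (x : Fin (suc k)) (u : Vec (Fin k) L) → multᵛ (map (punchIn x) u) x ≡ 0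
multᵛ-map-punchIn-self x = multᵛ-map-∉ (punchInᵢ≢i x)

covers-∷ : (x : Fin k) (r : Vec (Fin k) L) → Covers r → Covers (x ∷ r)
covers-∷ x r cov j = ≤-trans (cov j) (m≤n+m (multᵛ r j) (δ x j))

covers-∷⁻ : (x : Fin k) (r : Vec (Fin k) L) → Covers (x ∷ r) → ∀ {j} → x ≢ j → 0 < multᵛ r j
covers-∷⁻ x r cov {j} x≢j = subst (0 <_) (cong (_+ multᵛ r j) (δ-≢ x≢j)) (cov j)

covers-tail : (x : Fin k) (r : Vec (Fin k) L) → Covers (x ∷ r) → 0 < multᵛ r x → Covers r
covers-tail x r cov x∈r j with x ≟ j
... | yes refl = x∈r
... | no x≢j   = covers-∷⁻ x r cov x≢j

covers-punchOutᵛ : (x : Fin (suc k)) (r : Vec (Fin (suc k)) L) → Covers (x ∷ r) →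
  (h : multᵛ r x ≡ 0) → Covers (punchOutᵛ x r h)
covers-punchOutᵛ x r cov h j =
  subst (0 <_) (sym (multᵛ-punchOutᵛ x r h j)) (covers-∷⁻ x r cov (punchInᵢ≢i x j ∘ sym))

covers-insert : (x : Fin (suc k)) (u : Vec (Fin k) L) → Covers u → Covers (x ∷ map (punchIn x) u)
covers-insert x u cov j with x ≟ j
... | yes refl = s≤s z≤n
... | no x≢j   = subst (λ i → 0 < multᵛ (map (punchIn x) u) i) (punchIn-punchOut x≢j)
  (subst (0 <_) (sym (multᵛ-map-injective (punchIn-injective x _ _) u (punchOut x≢j))) (cov (punchOut x≢j)))

OntoCons : ℕ → ℕ → Set
OntoCons k L = (Fin (suc k) × Onto (suc k) L) ⊎ (Fin (suc k) × Onto k L)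

onto-∷↔ : Onto (suc k) (suc L) ↔ OntoCons k L
onto-∷↔ {k} {L} = mk↔ₛ′ to from to∘from from∘to
  where
  split : (x : Fin (suc k)) (r : Vec (Fin (suc k)) L) → Covers (x ∷ r) → Dec (multᵛ r x ≡ 0) → OntoCons k L
  split x r cov (yes x∉r) = inj₂ (x , punchOutᵛ x r x∉r , onto⁺ (punchOutᵛ x r x∉r) (covers-punchOutᵛ x r cov x∉r))
  split x r cov (no x∈r)  = inj₁ (x , r , onto⁺ r (covers-tail x r cov (n≢0⇒n>0 x∈r)))

  to : Onto (suc k) (suc L) → OntoCons k L
  to (x ∷ r , o) = split x r (onto⁻ (x ∷ r) o) (multᵛ r x ≟ 0)

  from : OntoCons k L → Onto (suc k) (suc L)
  from (inj₁ (x , r , o)) = x ∷ r , onto⁺ (x ∷ r) (covers-∷ x r (onto⁻ r o))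
  from (inj₂ (x , u , o)) = x ∷ map (punchIn x) u , onto⁺ (x ∷ map (punchIn x) u) (covers-insert x u (onto⁻ u o))

  to∘from : ∀ y → to (from y) ≡ y
  to∘from (inj₁ (x , r , o)) with multᵛ r x ≟ 0
  ... | yes x∉r = ⊥-elim (1+n≰n (subst (0 <_) x∉r (onto⁻ r o x)))
  ... | no _    = cong (λ o′ → inj₁ (x , r , o′)) (≡-irrelevant _ o)
  to∘from (inj₂ (x , u , o)) with multᵛ (map (punchIn x) u) x ≟ 0
  ... | yes x∉r = cong (λ v → inj₂ (x , v)) (Onto-≡ (punchOutᵛ-unique x x∉r refl))
  ... | no x∈r  = ⊥-elim (x∈r (multᵛ-map-punchIn-self x u))

  from∘to : ∀ y → from (to y) ≡ y
  from∘to (x ∷ r , o) with multᵛ r x ≟ 0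
  ... | yes x∉r = Onto-≡ (cong (x ∷_) (map-punchIn-punchOutᵛ x r x∉r))
  ... | no _    = Onto-≡ refl

surjections : ℕ → ℕ → ℕ
surjections zero    zero    = 1
surjections zero    (suc L) = 0
surjections (suc k) zero    = 0
surjections (suc k) (suc L) = suc k * surjections (suc k) L + suc k * surjections k L

onto↔surjections : ∀ k L → Onto k L ↔ Fin (surjections k L)
onto↔surjections zero    zero    =
  mk↔ₛ′ (λ _ → fzero) (λ _ → [] , refl) (λ { fzero → refl ; (fsuc ()) }) (λ { ([] , refl) → refl })
onto↔surjections zero    (suc L) = mk↔ₛ′ (λ { (() ∷ _ , _) }) (λ ()) (λ ()) (λ { (() ∷ _ , _) })
onto↔surjections (suc k) zero    = mk↔ₛ′ (λ { ([] , ()) }) (λ ()) (λ ()) (λ { ([] , ()) })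
onto↔surjections (suc k) (suc L) = ↔-trans onto-∷↔ (↔-trans
  ((↔-refl ×-↔ onto↔surjections (suc k) L) ⊎-↔ (↔-refl ×-↔ onto↔surjections k L))
  (↔-sym (↔-trans +↔⊎ (*↔× ⊎-↔ *↔×))))

surjections-< : ∀ k L → L < k → surjections k L ≡ 0
surjections-< (suc k) zero    _         = refl
surjections-< (suc k) (suc L) (s≤s L<k)
  rewrite surjections-< (suc k) L (m<n⇒m<1+n L<k) | surjections-< k L L<k | *-zeroʳ k = refl

surjections-diag : ∀ k → surjections k k ≡ k !
surjections-diag zero    = refl
surjections-diag (suc k) rewrite surjections-< (suc k) k (n<1+n k) | surjections-diag k | *-zeroʳ k = refl

surjections-1+diag : ∀ k → surjections k (suc k) * 2 ≡ suc k ! * k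
surjections-1+diag zero    = refl
surjections-1+diag (suc k) = begin
  (suc k * surjections (suc k) (suc k) + suc k * surjections k (suc k)) * 2
    ≡⟨ cong (λ s → (suc k * s + suc k * surjections k (suc k)) * 2) (surjections-diag (suc k)) ⟩
  (suc k * F + suc k * S) * 2        ≡⟨ *-distribʳ-+ 2 (suc k * F) (suc k * S) ⟩
  suc k * F * 2 + suc k * S * 2      ≡⟨ cong (suc k * F * 2 +_) (*-assoc (suc k) S 2) ⟩
  suc k * F * 2 + suc k * (S * 2)    ≡⟨ cong (λ t → suc k * F * 2 + suc k * t) (surjections-1+diag k) ⟩
  suc k * F * 2 + suc k * (F * k)    ≡⟨ regroup k F ⟩
  suc (suc k) * F * suc k            ∎
  where
  open ≡-Reasoning
  F = suc k !
  S = surjections k (suc k)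
  regroup : ∀ k F → suc k * F * 2 + suc k * (F * k) ≡ suc (suc k) * F * suc k
  regroup = solve-∀

firstFree-here : ∀ occ s f → mult occ s ≡ 0 → firstFree occ s (suc f) ≡ just s
firstFree-here occ s f s-free with s ∈? occ
... | yes s∈occ = ⊥-elim (1+n≰n (subst (0 <_) s-free (∈⇒0<mult occ s∈occ)))
... | no _      = refl

firstFree-next : ∀ occ s f → 0 < mult occ s → firstFree occ s (suc f) ≡ firstFree occ (suc s) f
firstFree-next occ s f s-taken with s ∈? occ
... | yes _     = refl
... | no s∉occ  = ⊥-elim (s∉occ (0<mult⇒∈ occ s-taken))

record FirstFree (occ : List ℕ) (s f p : ℕ) : Set where
  field
    s≤p     : s ≤ p
    p<s+f   : p < s + f
    p-free  : mult occ p ≡ 0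
    s-taken : p ≡ s ⊎ 0 < mult occ s

firstFree-spec : ∀ occ s f {p} → firstFree occ s f ≡ just p → FirstFree occ s f p
firstFree-spec occ s (suc f) {p} eq with s ∈? occ
... | no s∉occ with refl ← eq = record
  { s≤p = ≤-refl ; p<s+f = subst (s <_) (sym (+-suc s f)) (s≤s (m≤m+n s f))
  ; p-free = n≤0⇒n≡0 (≮⇒≥ (s∉occ ∘ 0<mult⇒∈ occ)) ; s-taken = inj₁ refl }
... | yes s∈occ = record
  { s≤p = ≤-trans (n≤1+n s) s≤p ; p<s+f = subst (p <_) (sym (+-suc s f)) p<s+f
  ; p-free = p-free ; s-taken = inj₂ (∈⇒0<mult occ s∈occ) }
  where open FirstFree (firstFree-spec occ (suc s) f eq)

parked-< : ∀ {n} occ a {p} → firstFree occ a (n ∸ a) ≡ just p → p < n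
parked-< {n} occ a {p} ff with a ≤? n
... | yes a≤n = subst (p <_) (m+[n∸m]≡n a≤n) (FirstFree.p<s+f (firstFree-spec occ a (n ∸ a) ff))
... | no a≰n  = ⊥-elim (<⇒≱ p<a (FirstFree.s≤p (firstFree-spec occ a (n ∸ a) ff)))
  where
  p<a : p < a
  p<a = subst (p <_) (trans (cong (a +_) (m≤n⇒m∸n≡0 (<⇒≤ (≰⇒> a≰n)))) (+-identityʳ a))
          (FirstFree.p<s+f (firstFree-spec occ a (n ∸ a) ff))

parked-offset : ∀ occ a f {p} d → firstFree occ a f ≡ just p → p ∸ a ≡ d → p ≡ d + a
parked-offset occ a f {p} d ff p∸a≡d =
  trans (sym (m+[n∸m]≡n (FirstFree.s≤p (firstFree-spec occ a f ff)))) (trans (cong (a +_) p∸a≡d) (+-comm a d))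

parks-at-pref : ∀ {n} occ a → a < n → mult occ a ≡ 0 → firstFree occ a (n ∸ a) ≡ just a
parks-at-pref {suc n} occ a (s≤s a≤n) a-free rewrite +-∸-assoc 1 a≤n = firstFree-here occ a (n ∸ a) a-free

parks-next : ∀ {n} occ a → suc a < n → 0 < mult occ a → mult occ (suc a) ≡ 0 →
  firstFree occ a (n ∸ a) ≡ just (suc a)
parks-next {suc n} occ a (s≤s a<n) a-taken next-free rewrite +-∸-assoc 1 (<⇒≤ a<n) =
  trans (firstFree-next occ a (n ∸ a) a-taken) (parks-at-pref {suc n} occ (suc a) (s≤s a<n) next-free)

runParking-∷ : ∀ n occ a as {p} → firstFree occ a (n ∸ a) ≡ just p →
  runParking n occ (a ∷ as) ≡ Data.Maybe.map ((p ∸ a) +_) (runParking n (p ∷ occ) as)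
runParking-∷ n occ a as ff rewrite ff = refl

runParking-∷⁻ : ∀ n occ a as {d} → runParking n occ (a ∷ as) ≡ just d →
  ∃[ p ] ∃[ r ] firstFree occ a (n ∸ a) ≡ just p × runParking n (p ∷ occ) as ≡ just r × (p ∸ a) + r ≡ d
runParking-∷⁻ n occ a as eq with firstFree occ a (n ∸ a)
... | nothing with () ← eq
... | just p with runParking n (p ∷ occ) as in run
...   | nothing with () ← eq
...   | just r = p , r , refl , run , just-injective eq

load : List ℕ → List ℕ → ℕ → ℕ
load occ as j = mult occ j + mult as j

load-shift : ∀ a occ as j → load (a ∷ occ) as j ≡ load occ (a ∷ as) j
load-shift a occ as j = regroup (δ a j) (mult occ j) (mult as j)
  where
  regroup : ∀ x o r → x + o + r ≡ o + (x + r)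
  regroup = solve-∀

load-self : ∀ a occ as → load occ (a ∷ as) a ≡ suc (load occ as a)
load-self a occ as rewrite δ-refl a = +-suc (mult occ a) (mult as a)

AtMostOnce : (ℕ → ℕ) → Set
AtMostOnce c = ∀ j → c j ≤ 1

AtMostOnce-∷ : ∀ a occ → AtMostOnce (mult occ) → mult occ a ≡ 0 → AtMostOnce (mult (a ∷ occ))
AtMostOnce-∷ a occ occ-ok a-free j with a ≟ j
... | yes refl = subst (_≤ 1) (sym (cong₂ _+_ (δ-refl a) a-free)) ≤-refl
... | no a≢j   = subst (_≤ 1) (sym (cong (_+ mult occ j) (δ-≢ a≢j))) (occ-ok j)

displacement0⇒ : ∀ n occ as → AtMostOnce (mult occ) → runParking n occ as ≡ just 0 → AtMostOnce (load occ as)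
displacement0⇒ n occ []       occ-ok _  j = subst (_≤ 1) (sym (+-identityʳ (mult occ j))) (occ-ok j)
displacement0⇒ n occ (a ∷ as) occ-ok eq j with runParking-∷⁻ n occ a as eq
... | p , r , ff , run , p∸a+r≡0 with refl ← parked-offset occ a (n ∸ a) 0 ff (m+n≡0⇒m≡0 (p ∸ a) p∸a+r≡0)
                                   | refl ← m+n≡0⇒n≡0 (p ∸ a) p∸a+r≡0 =
  subst (_≤ 1) (load-shift a occ as j) (displacement0⇒ n (a ∷ occ) as occ′-ok run j)
  where occ′-ok = AtMostOnce-∷ a occ occ-ok (FirstFree.p-free (firstFree-spec occ a (n ∸ a) ff))

displacement0⇐ : ∀ n occ as → All (_< n) as → AtMostOnce (load occ as) → runParking n occ as ≡ just 0
displacement0⇐ n occ []       []           ok = refl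
displacement0⇐ n occ (a ∷ as) (a<n ∷ as<n) ok = begin
  runParking n occ (a ∷ as)                                ≡⟨ runParking-∷ n occ a as (parks-at-pref occ a a<n a-free) ⟩
  Data.Maybe.map ((a ∸ a) +_) (runParking n (a ∷ occ) as)  ≡⟨ cong (Data.Maybe.map _) (displacement0⇐ n (a ∷ occ) as as<n ok′) ⟩
  just (a ∸ a + 0)                                         ≡⟨ cong (λ d → just (d + 0)) (n∸n≡0 a) ⟩
  just 0                                                   ∎
  where
  open ≡-Reasoning
  a-free : mult occ a ≡ 0
  a-free = m+n≡0⇒m≡0 _ (n≤0⇒n≡0 (≤-pred (subst (_≤ 1) (load-self a occ as) (ok a))))
  ok′ : AtMostOnce (load (a ∷ occ) as)
  ok′ j = subst (_≤ 1) (sym (load-shift a occ as j)) (ok j)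

record CollisionAt (n : ℕ) (c : ℕ → ℕ) (w : ℕ) : Set where
  field
    w+1<n      : suc w < n
    twice      : c w ≡ 2
    next-empty : c (suc w) ≡ 0
    others     : ∀ j → j ≢ w → j ≢ suc w → c j ≤ 1

OneCollision : ℕ → (ℕ → ℕ) → Set
OneCollision n c = ∃ (CollisionAt n c)

OneCollision-resp : ∀ {n c c′} → (∀ j → c j ≡ c′ j) → OneCollision n c → OneCollision n c′
OneCollision-resp c≗c′ (w , col) = w , record
  { w+1<n = w+1<n ; twice = trans (sym (c≗c′ w)) twice ; next-empty = trans (sym (c≗c′ (suc w))) next-empty
  ; others = λ j j≢w j≢w+1 → subst (_≤ 1) (c≗c′ j) (others j j≢w j≢w+1) }
  where open CollisionAt col

2≤load-taken : ∀ a occ as → 0 < mult occ a → 2 ≤ load occ (a ∷ as) a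
2≤load-taken a occ as a-taken =
  subst (2 ≤_) (sym (load-self a occ as)) (s≤s (≤-trans a-taken (m≤m+n (mult occ a) (mult as a))))

-- A car preferring the taken spot a and parking at a + 1 turns a load that is at most 1
-- everywhere into one that is 2 at a and 0 at a + 1, and conversely.
module _ (a : ℕ) (occ as : List ℕ) where

  displace-at-pref : load occ (a ∷ as) a ≡ suc (load (suc a ∷ occ) as a)
  displace-at-pref rewrite δ-≢ (1+n≢n {a}) = load-self a occ as

  displace-at-next : suc (load occ (a ∷ as) (suc a)) ≡ load (suc a ∷ occ) as (suc a)
  displace-at-next rewrite δ-≢ (1+n≢n {a} ∘ sym) | δ-refl (suc a) = refl

  displace-elsewhere : ∀ j → j ≢ a → j ≢ suc a → load occ (a ∷ as) j ≡ load (suc a ∷ occ) as j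
  displace-elsewhere j j≢a j≢a+1 rewrite δ-≢ (j≢a ∘ sym) | δ-≢ (j≢a+1 ∘ sym) = refl

  displaced⇒collision : 0 < mult occ a → ∀ {n} → suc a < n →
    AtMostOnce (load (suc a ∷ occ) as) → CollisionAt n (load occ (a ∷ as)) a
  displaced⇒collision a-taken a+1<n rest-ok = record
    { w+1<n = a+1<n ; twice = twice ; next-empty = next-empty ; others = others }
    where
    twice : load occ (a ∷ as) a ≡ 2
    twice = trans displace-at-pref (cong suc (≤-antisym (rest-ok a)
      (≤-pred (subst (2 ≤_) displace-at-pref (2≤load-taken a occ as a-taken)))))
    next-empty : load occ (a ∷ as) (suc a) ≡ 0
    next-empty = n≤0⇒n≡0 (≤-pred (subst (_≤ 1) (sym displace-at-next) (rest-ok (suc a))))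
    others : ∀ j → j ≢ a → j ≢ suc a → load occ (a ∷ as) j ≤ 1
    others j j≢a j≢a+1 = subst (_≤ 1) (sym (displace-elsewhere j j≢a j≢a+1)) (rest-ok j)

  collision⇒displaced : ∀ {n} → CollisionAt n (load occ (a ∷ as)) a → AtMostOnce (load (suc a ∷ occ) as)
  collision⇒displaced col j with j ≟ a | j ≟ suc a
  ... | yes refl | _        = ≤-reflexive (suc-injective (trans (sym displace-at-pref) (CollisionAt.twice col)))
  ... | no _     | yes refl = ≤-reflexive (trans (sym displace-at-next) (cong suc (CollisionAt.next-empty col)))
  ... | no j≢a   | no j≢a+1 =
    subst (_≤ 1) (displace-elsewhere j j≢a j≢a+1) (CollisionAt.others col j j≢a j≢a+1)

occupied⇒collision-spot : ∀ {n w} occ a as → CollisionAt n (load occ (a ∷ as)) w → 0 < mult occ a → a ≡ w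
occupied⇒collision-spot {w = w} occ a as col a-taken with a ≟ w | a ≟ suc w
... | yes a≡w | _          = a≡w
... | no _    | yes refl
  with () ← subst (2 ≤_) (CollisionAt.next-empty col) (2≤load-taken a occ as a-taken)
... | no a≢w  | no a≢w+1   = ⊥-elim (1+n≰n (≤-trans (2≤load-taken a occ as a-taken) (others a a≢w a≢w+1)))
  where open CollisionAt col

displacement1⇒ : ∀ n occ as → AtMostOnce (mult occ) → runParking n occ as ≡ just 1 → OneCollision n (load occ as)
displacement1⇒ n occ (a ∷ as) occ-ok eq with runParking-∷⁻ n occ a as eq
... | p , r , ff , run , p∸a+r≡1 with p ∸ a in p∸a
...   | zero with refl ← p∸a+r≡1 | refl ← parked-offset occ a (n ∸ a) 0 ff p∸a =
  OneCollision-resp (load-shift a occ as) (displacement1⇒ n (a ∷ occ) as occ′-ok run)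
  where occ′-ok = AtMostOnce-∷ a occ occ-ok (FirstFree.p-free (firstFree-spec occ a (n ∸ a) ff))
...   | suc zero with refl ← p∸a+r≡1 | refl ← parked-offset occ a (n ∸ a) 1 ff p∸a =
  a , displaced⇒collision a occ as a-taken (parked-< occ a ff) (displacement0⇒ n (suc a ∷ occ) as occ′-ok run)
  where
  spec = firstFree-spec occ a (n ∸ a) ff
  a-taken : 0 < mult occ a
  a-taken = [ (λ a+1≡a → ⊥-elim (1+n≢n a+1≡a)) , (λ taken → taken) ]′ (FirstFree.s-taken spec)
  occ′-ok = AtMostOnce-∷ (suc a) occ occ-ok (FirstFree.p-free spec)

displacement1⇐ : ∀ n occ as → All (_< n) as → AtMostOnce (mult occ) → OneCollision n (load occ as) →
  runParking n occ as ≡ just 1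
displacement1⇐ n occ []       []           occ-ok (w , col) =
  ⊥-elim (1+n≰n (subst (_≤ 1) (trans (sym (+-identityʳ _)) (CollisionAt.twice col)) (occ-ok w)))
displacement1⇐ n occ (a ∷ as) (a<n ∷ as<n) occ-ok (w , col) with mult occ a ≟ 0
... | yes a-free = begin
  runParking n occ (a ∷ as)                                ≡⟨ runParking-∷ n occ a as (parks-at-pref occ a a<n a-free) ⟩
  Data.Maybe.map ((a ∸ a) +_) (runParking n (a ∷ occ) as)  ≡⟨ cong (Data.Maybe.map _) rest ⟩
  just (a ∸ a + 1)                                         ≡⟨ cong (λ d → just (d + 1)) (n∸n≡0 a) ⟩
  just 1                                                   ∎
  where
  open ≡-Reasoning
  rest = displacement1⇐ n (a ∷ occ) as as<n (AtMostOnce-∷ a occ occ-ok a-free)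
           (OneCollision-resp (sym ∘ load-shift a occ as) (w , col))
... | no a-taken with refl ← occupied⇒collision-spot occ a as col (n≢0⇒n>0 a-taken) = begin
  runParking n occ (a ∷ as)                                             ≡⟨ runParking-∷ n occ a as parks ⟩
  Data.Maybe.map ((suc a ∸ a) +_) (runParking n (suc a ∷ occ) as)       ≡⟨ cong (Data.Maybe.map _) rest ⟩
  just (suc a ∸ a + 0)                                                  ≡⟨ cong (λ d → just (d + 0)) (m+n∸n≡m 1 a) ⟩
  just 1                                                                ∎
  where
  open ≡-Reasoning
  open CollisionAt col
  next-free : mult occ (suc a) ≡ 0
  next-free = m+n≡0⇒m≡0 _ next-empty
  parks = parks-next occ a w+1<n (n≢0⇒n>0 a-taken) next-free
  rest = displacement0⇐ n (suc a ∷ occ) as as<n (collision⇒displaced a occ as col)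

preferences : {n : ℕ} → Vec (Fin n) L → List ℕ
preferences α = Data.List.map toℕ (toList α)

mult-preferences : {n : ℕ} (α : Vec (Fin n) L) (j : Fin n) → mult (preferences α) (toℕ j) ≡ multᵛ α j
mult-preferences α = mult-map-injective toℕ-injective (toList α)

mult-preferences-≥ : {n : ℕ} (α : Vec (Fin n) L) {j : ℕ} → n ≤ j → mult (preferences α) j ≡ 0
mult-preferences-≥ α {j} n≤j = mult-map-∉ (λ x toℕx≡j → <⇒≱ (toℕ<n x) (subst (_ ≤_) (sym toℕx≡j) n≤j)) (toList α)

preferences<n : {n : ℕ} (α : Vec (Fin n) L) → All (_< n) (preferences α)
preferences<n []      = []
preferences<n (x ∷ α) = toℕ<n x ∷ preferences<n α

-- Spots w and w + 1 are inject₁ w and fsuc w as elements of Fin (suc k).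
record Collision (α : Vec (Fin (suc k)) L) (w : Fin k) : Set where
  field
    next-missing : multᵛ α (fsuc w) ≡ 0
    twice        : multᵛ α (inject₁ w) ≡ 2
    others       : ∀ j → j ≢ fsuc w → j ≢ inject₁ w → multᵛ α j ≤ 1

collisionAt⇒collision : (α : Vec (Fin (suc k)) L) {w : ℕ} →
  CollisionAt (suc k) (mult (preferences α)) w → Σ (Fin k) (Collision α)
collisionAt⇒collision α {w} col = w′ , record
  { next-missing = trans (sym (mult-preferences α (fsuc w′))) (trans (cong (mult (preferences α) ∘ suc) toℕw′) next-empty)
  ; twice        = trans (sym (mult-preferences α (inject₁ w′))) (trans (cong (mult (preferences α)) toℕ-inject₁w′) twice)
  ; others       = λ j j≢w′+1 j≢w′ → subst (_≤ 1) (mult-preferences α j) (others (toℕ j)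
      (λ e → j≢w′ (toℕ-injective (trans e (sym toℕ-inject₁w′))))
      (λ e → j≢w′+1 (toℕ-injective (trans e (cong suc (sym toℕw′)))))) }
  where
  open CollisionAt col
  w′ = fromℕ< (≤-pred w+1<n)
  toℕw′ : toℕ w′ ≡ w
  toℕw′ = toℕ-fromℕ< (≤-pred w+1<n)
  toℕ-inject₁w′ : toℕ (inject₁ w′) ≡ w
  toℕ-inject₁w′ = trans (toℕ-inject₁ w′) toℕw′

collision⇒collisionAt : (α : Vec (Fin (suc k)) L) {w : Fin k} →
  Collision α w → CollisionAt (suc k) (mult (preferences α)) (toℕ w)
collision⇒collisionAt {k} α {w} col = record
  { w+1<n      = s≤s (toℕ<n w)
  ; twice      = trans (cong (mult (preferences α)) (sym (toℕ-inject₁ w))) (trans (mult-preferences α (inject₁ w)) twice)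
  ; next-empty = trans (mult-preferences α (fsuc w)) next-missing
  ; others     = others′ }
  where
  open Collision col
  others′ : ∀ j → j ≢ toℕ w → j ≢ suc (toℕ w) → mult (preferences α) j ≤ 1
  others′ j j≢w j≢w+1 with j <? suc k
  ... | no j≮n  = subst (_≤ 1) (sym (mult-preferences-≥ α (≮⇒≥ j≮n))) z≤n
  ... | yes j<n = subst (_≤ 1) (trans (sym (mult-preferences α j′)) (cong (mult (preferences α)) toℕj′))
      (others j′ (λ e → j≢w+1 (trans (sym toℕj′) (cong toℕ e)))
                (λ e → j≢w (trans (sym toℕj′) (trans (cong toℕ e) (toℕ-inject₁ w)))))
    where
    j′ = fromℕ< j<n
    toℕj′ : toℕ j′ ≡ j
    toℕj′ = toℕ-fromℕ< j<n

pf⇒collision : (α : Vec (Fin (suc k)) (suc k)) → parkingOutcome α ≡ just 1 → Σ (Fin k) (Collision α)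
pf⇒collision {k} α pf = collisionAt⇒collision α (proj₂ (displacement1⇒ (suc k) [] (preferences α) (λ _ → z≤n) pf))

collision⇒pf : (α : Vec (Fin (suc k)) (suc k)) {w : Fin k} → Collision α w → parkingOutcome α ≡ just 1
collision⇒pf {k} α {w} col =
  displacement1⇐ (suc k) [] (preferences α) (preferences<n α) (λ _ → z≤n) (toℕ w , collision⇒collisionAt α col)

DoubledAt : (Fin k → ℕ) → Fin k → Set
DoubledAt c w = ∀ j → c j ≡ 1 + δ w j

doubledAt-unique : {c : Fin k → ℕ} {w w′ : Fin k} → DoubledAt c w → DoubledAt c w′ → w ≡ w′
doubledAt-unique {c = c} {w} {w′} d d′ with w ≟ w′
... | yes w≡w′ = w≡w′
... | no w≢w′  = ⊥-elim (0≢1+n (trans (sym (δ-≢ (w≢w′ ∘ sym))) (suc-injective (trans (sym (d′ w)) (trans (d w) (cong suc (δ-refl w)))))))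

doubledAt⇒covers : (v : Vec (Fin k) L) (w : Fin k) → DoubledAt (multᵛ v) w → Covers v
doubledAt⇒covers v w d j = subst (0 <_) (sym (d j)) (s≤s z≤n)

sum-1+δ : (w : Fin k) → sum (λ j → 1 + δ w j) ≡ suc k
sum-1+δ {k} w = trans (∑-distrib-+ (λ _ → 1) (δ w)) (trans (cong₂ _+_ (sum-ones k) (sum-δ w)) (+-comm k 1))

onto-doubledAt : (v : Vec (Fin k) (suc k)) → Covers v → ∃ (DoubledAt (multᵛ v))
onto-doubledAt {k} v cov with any? (λ j → 2 ≤? multᵛ v j)
... | yes (w , 2≤vw) = w , λ j → sym (≤-sum-≡⇒≗ (λ j → 1 + δ w j) (multᵛ v) lower
                                        (trans (sum-1+δ w) (sym (sum-multᵛ v))) j)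
  where
  lower : ∀ j → 1 + δ w j ≤ multᵛ v j
  lower j with w ≟ j
  ... | yes refl = 2≤vw
  ... | no _     = cov j
... | no none = ⊥-elim (1+n≰n (begin
  suc k                  ≡⟨ sum-multᵛ v ⟨
  sum (multᵛ v)          ≤⟨ sum-mono-≤ (multᵛ v) (λ _ → 1) (λ j → ≤-pred (≰⇒> (λ 2≤vj → none (j , 2≤vj)))) ⟩
  sum {k} (λ _ → 1)      ≡⟨ sum-ones k ⟩
  k                      ∎))
  where open Data.Nat.Properties.≤-Reasoning

punchIn-suc-self : (w : Fin k) → punchIn (fsuc w) w ≡ inject₁ w
punchIn-suc-self fzero    = refl
punchIn-suc-self (fsuc w) = cong fsuc (punchIn-suc-self w)

collision⇒doubledAt : (α : Vec (Fin (suc k)) (suc k)) {w : Fin k} (col : Collision α w) →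
  DoubledAt (multᵛ (punchOutᵛ (fsuc w) α (Collision.next-missing col))) w
collision⇒doubledAt α {w} col =
  ≤-sum-≡⇒≗ (multᵛ α′) (λ j → 1 + δ w j) upper (trans (sum-multᵛ α′) (sym (sum-1+δ w)))
  where
  open Collision col
  α′ = punchOutᵛ (fsuc w) α next-missing
  upper : ∀ j → multᵛ α′ j ≤ 1 + δ w j
  upper j rewrite multᵛ-punchOutᵛ (fsuc w) α next-missing j with w ≟ j
  ... | yes refl = ≤-reflexive (trans (cong (multᵛ α) (punchIn-suc-self w)) twice)
  ... | no w≢j   = others (punchIn (fsuc w) j) (punchInᵢ≢i (fsuc w) j)
    (λ e → w≢j (punchIn-injective (fsuc w) w j (trans (punchIn-suc-self w) (sym e))))

doubledAt⇒collision : (v : Vec (Fin k) L) {w : Fin k} → DoubledAt (multᵛ v) w →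
  Collision (map (punchIn (fsuc w)) v) w
doubledAt⇒collision v {w} d = record
  { next-missing = multᵛ-map-punchIn-self (fsuc w) v
  ; twice        = begin
      multᵛ (map ι v) (inject₁ w) ≡⟨ cong (multᵛ (map ι v)) (punchIn-suc-self w) ⟨
      multᵛ (map ι v) (ι w)       ≡⟨ multᵛ-map-injective ι-injective v w ⟩
      multᵛ v w                   ≡⟨ d w ⟩
      1 + δ w w                   ≡⟨ cong suc (δ-refl w) ⟩
      2                           ∎
  ; others       = others }
  where
  open ≡-Reasoning
  ι = punchIn (fsuc w)
  ι-injective : Injective _≡_ _≡_ ι
  ι-injective = punchIn-injective (fsuc w) _ _
  others : ∀ j → j ≢ fsuc w → j ≢ inject₁ w → multᵛ (map ι v) j ≤ 1
  others j j≢w+1 j≢w = ≤-reflexive (begin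
    multᵛ (map ι v) j          ≡⟨ cong (multᵛ (map ι v)) (punchIn-punchOut w+1≢j) ⟨
    multᵛ (map ι v) (ι j′)     ≡⟨ multᵛ-map-injective ι-injective v j′ ⟩
    multᵛ v j′                 ≡⟨ d j′ ⟩
    1 + δ w j′                 ≡⟨ cong suc (δ-≢ w≢j′) ⟩
    1                          ∎)
    where
    w+1≢j = j≢w+1 ∘ sym
    j′ = punchOut w+1≢j
    w≢j′ : w ≢ j′
    w≢j′ w≡j′ = j≢w (trans (sym (punchIn-punchOut w+1≢j)) (trans (cong ι (sym w≡j′)) (punchIn-suc-self w)))

collision-unique : (α : Vec (Fin (suc k)) L) {w w′ : Fin k} → Collision α w → Collision α w′ → w ≡ w′
collision-unique α {w} {w′} col col′ with w ≟ w′
... | yes w≡w′ = w≡w′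
... | no w≢w′ with inject₁ w′ ≟ fsuc w
...   | yes w′≡w+1 = ⊥-elim (0≢1+n (trans (sym next-missing) (trans (cong (multᵛ α) (sym w′≡w+1)) (Collision.twice col′))))
  where open Collision col
...   | no w′≢w+1  = ⊥-elim (1+n≰n (subst (_≤ 1) (Collision.twice col′)
                       (others (inject₁ w′) w′≢w+1 (w≢w′ ∘ sym ∘ inject₁-injective))))
  where open Collision col

pf↔onto : ∀ k → PF (suc k) ↔ Onto k (suc k)
pf↔onto k = subset-↔ (Decidable⇒UIP.≡-irrelevant (≡-decᵐ Data.Nat.Properties._≟_)) ≡-irrelevant to from to∘from from∘to
  where
  to : PF (suc k) → Onto k (suc k)
  to (α , pf) = α′ , onto⁺ α′ (doubledAt⇒covers α′ w (collision⇒doubledAt α col))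
    where
    w = proj₁ (pf⇒collision α pf)
    col = proj₂ (pf⇒collision α pf)
    α′ = punchOutᵛ (fsuc w) α (Collision.next-missing col)

  from : Onto k (suc k) → PF (suc k)
  from (v , o) = map (punchIn (fsuc w)) v , collision⇒pf _ (doubledAt⇒collision v d)
    where
    w = proj₁ (onto-doubledAt v (onto⁻ v o))
    d = proj₂ (onto-doubledAt v (onto⁻ v o))

  to∘from : ∀ y → proj₁ (to (from y)) ≡ proj₁ y
  to∘from (v , o) = punchOutᵛ-unique (fsuc w′) _ (cong (λ x → map (punchIn (fsuc x)) v) w′≡w)
    where
    w = proj₁ (onto-doubledAt v (onto⁻ v o))
    d = proj₂ (onto-doubledAt v (onto⁻ v o))
    α = map (punchIn (fsuc w)) v
    w′ = proj₁ (pf⇒collision α (collision⇒pf α (doubledAt⇒collision v d)))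
    w′≡w : w′ ≡ w
    w′≡w = collision-unique α (proj₂ (pf⇒collision α _)) (doubledAt⇒collision v d)

  from∘to : ∀ x → proj₁ (from (to x)) ≡ proj₁ x
  from∘to (α , pf) = trans (cong (λ x → map (punchIn (fsuc x)) α′) w″≡w) (map-punchIn-punchOutᵛ (fsuc w) α next-missing)
    where
    w = proj₁ (pf⇒collision α pf)
    col = proj₂ (pf⇒collision α pf)
    open Collision col
    α′ = punchOutᵛ (fsuc w) α next-missing
    w″ = proj₁ (onto-doubledAt α′ (onto⁻ α′ (onto⁺ α′ (doubledAt⇒covers α′ w (collision⇒doubledAt α col)))))
    w″≡w : w″ ≡ w
    w″≡w = doubledAt-unique (proj₂ (onto-doubledAt α′ _)) (collision⇒doubledAt α col)

n<ᵇn : ∀ n → (n <ᵇ n) ≡ false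
n<ᵇn zero    = refl
n<ᵇn (suc n) = n<ᵇn n

punchIn-fromℕ : (q : Fin k) → punchIn (fromℕ k) q ≡ inject₁ q
punchIn-fromℕ fzero    = refl
punchIn-fromℕ (fsuc q) = cong fsuc (punchIn-fromℕ q)

-- The interior pegs 1, …, k of the game with pegs 0, …, k + 1.
peg : Fin k → Fin (suc (suc k))
peg {k} q = fsuc (punchIn (fromℕ k) q)

peg-injective : Injective _≡_ _≡_ (peg {k})
peg-injective {k} = punchIn-injective (fromℕ k) _ _ ∘ Data.Fin.Properties.suc-injective

peg≢top : (q : Fin k) → peg q ≢ fromℕ (suc k)
peg≢top {k} q = punchInᵢ≢i (fromℕ k) q ∘ Data.Fin.Properties.suc-injective

peg-interior : (q : Fin k) → isInterior {suc k} (peg q) ≡ true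
peg-interior {k} q = <⇒<ᵇ≡true (subst (_< k) (sym (trans (cong toℕ (punchIn-fromℕ q)) (toℕ-inject₁ q))) (toℕ<n q))

not-interior⊎peg : (p : Fin (suc (suc k))) → isInterior {suc k} p ≡ false ⊎ ∃[ q ] peg q ≡ p
not-interior⊎peg     fzero    = inj₁ refl
not-interior⊎peg {k} (fsuc p) with fromℕ k ≟ p
... | yes refl = inj₁ (trans (cong (_<ᵇ k) (toℕ-fromℕ k)) (n<ᵇn k))
... | no top≢p = inj₂ (punchOut top≢p , cong fsuc (punchIn-punchOut top≢p))

module _ {k : ℕ} (s : HanoiState (suc k)) (ideal : IsIdeal (suc k) s) where

  private
    diskCount-init : ∀ p → diskCount s p ≡ multᵛ (init s) p + δ (last s) p
    diskCount-init p = trans (length-filter-≟ s p) (multᵛ-init-last s p)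

  last≡0 : last s ≡ fzero
  last≡0 = trans (sym (lookup-fromℕ s)) (proj₁ ideal)

  init-avoids-0 : multᵛ (init s) fzero ≡ 0
  init-avoids-0 = +-cancelʳ-≡ 1 _ 0 (begin
    multᵛ (init s) fzero + 1                 ≡⟨ cong (multᵛ (init s) fzero +_) δ-last ⟨
    multᵛ (init s) fzero + δ (last s) fzero  ≡⟨ diskCount-init fzero ⟨
    diskCount s fzero                        ≡⟨ proj₁ (proj₂ ideal) ⟩
    1                                        ∎)
    where
    open ≡-Reasoning
    δ-last : δ (last s) fzero ≡ 1
    δ-last = trans (cong (λ x → δ x fzero) last≡0) (δ-refl (fzero {suc k}))

  init-avoids-top : multᵛ (init s) (fromℕ (suc k)) ≡ 0
  init-avoids-top = m+n≡0⇒m≡0 _ (trans (sym (diskCount-init (fromℕ (suc k)))) (proj₁ (proj₂ (proj₂ ideal))))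

  init-covers-pegs : ∀ q → 0 < multᵛ (init s) (peg q)
  init-covers-pegs q = subst (0 <_) count (<ᵇ≡true⇒< 0 _ occupied)
    where
    occupied : (0 <ᵇ diskCount s (peg q)) ≡ true
    occupied with allᵇ-tabulate⁻ (λ p → not (isInterior p) ∨ (0 <ᵇ diskCount s p)) (λ p → p) (proj₂ (proj₂ (proj₂ ideal))) (peg q)
    ... | ok rewrite peg-interior q = ok
    count : diskCount s (peg q) ≡ multᵛ (init s) (peg q)
    count = trans (diskCount-init (peg q))
      (trans (cong (λ x → multᵛ (init s) (peg q) + δ x (peg q)) last≡0) (+-identityʳ _))

  -- The pegs of the disks 0, …, k, the interior peg (peg q) being renamed q.
  interiorDisks : Vec (Fin k) (suc k)
  interiorDisks = punchOutᵛ (fromℕ k) (punchOutᵛ fzero (init s) init-avoids-0)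
    (trans (multᵛ-punchOutᵛ fzero (init s) init-avoids-0 (fromℕ k)) init-avoids-top)

  multᵛ-interiorDisks : ∀ q → multᵛ interiorDisks q ≡ multᵛ (init s) (peg q)
  multᵛ-interiorDisks q = trans (multᵛ-punchOutᵛ (fromℕ k) (punchOutᵛ fzero (init s) init-avoids-0) _ q) (multᵛ-punchOutᵛ fzero (init s) _ (punchIn (fromℕ k) q))

  map-peg-interiorDisks : map peg interiorDisks ≡ init s
  map-peg-interiorDisks = trans (map-∘ fsuc (punchIn (fromℕ k)) interiorDisks)
    (trans (cong (map fsuc) (map-punchIn-punchOutᵛ (fromℕ k) _ _)) (map-punchIn-punchOutᵛ fzero (init s) _))

pegState : Vec (Fin k) (suc k) → HanoiState (suc k)
pegState v = map peg v ∷ʳ fzero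

pegState-ideal : (v : Vec (Fin k) (suc k)) → Covers v → IsIdeal (suc k) (pegState v)
pegState-ideal {k} v cov = lookup-∷ʳ-fromℕ (map peg v) fzero , on-0 , on-top ,
  allᵇ-tabulate⁺ (λ p → not (isInterior p) ∨ (0 <ᵇ diskCount (pegState v) p)) (λ p → p) interior
  where
  diskCount-pegs : ∀ p → diskCount (pegState v) p ≡ multᵛ (map peg v) p + δ fzero p
  diskCount-pegs p = trans (length-filter-≟ (pegState v) p) (multᵛ-∷ʳ (map peg v) fzero p)
  on-0 : diskCount (pegState v) fzero ≡ 1
  on-0 = trans (diskCount-pegs fzero) (cong₂ _+_ (multᵛ-map-∉ (λ q ()) v) (δ-refl (fzero {suc k})))
  on-top : diskCount (pegState v) (fromℕ (suc k)) ≡ 0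
  on-top = trans (diskCount-pegs (fromℕ (suc k))) (cong₂ _+_ (multᵛ-map-∉ peg≢top v) (δ-≢ {x = fzero} {fromℕ (suc k)} (λ ())))
  interior : ∀ p → (not (isInterior p) ∨ (0 <ᵇ diskCount (pegState v) p)) ≡ true
  interior p with not-interior⊎peg p
  ... | inj₁ not-interior rewrite not-interior = refl
  ... | inj₂ (q , refl) rewrite peg-interior q = <⇒<ᵇ≡true (subst (0 <_) (sym count) (cov q))
    where
    count : diskCount (pegState v) (peg q) ≡ multᵛ v q
    count = trans (diskCount-pegs (peg q))
      (trans (cong₂ _+_ (multᵛ-map-injective peg-injective v q) (δ-≢ {x = fzero} {peg q} (λ ()))) (+-identityʳ _))

interiorDisks-pegState : (v : Vec (Fin k) (suc k)) (ideal : IsIdeal (suc k) (pegState v)) → interiorDisks (pegState v) ideal ≡ v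
interiorDisks-pegState {k} v ideal = punchOutᵛ-unique (fromℕ k) _ (sym (punchOutᵛ-unique fzero _ map-pegs))
  where
  map-pegs : map fsuc (map (punchIn (fromℕ k)) v) ≡ init (pegState v)
  map-pegs = trans (sym (map-∘ fsuc (punchIn (fromℕ k)) v)) (sym (init-∷ʳ fzero (map peg v)))

IsIdeal-irrelevant : ∀ {n} {s : HanoiState n} (p q : IsIdeal n s) → p ≡ q
IsIdeal-irrelevant (a , b , c , d) (a′ , b′ , c′ , d′) =
  cong₂ _,_ (≡-irrelevant a a′) (cong₂ _,_ (≡-irrelevant b b′) (cong₂ _,_ (≡-irrelevant c c′) (≡-irrelevant d d′)))

ideal↔onto : ∀ k → TH (suc k) ↔ Onto k (suc k)
ideal↔onto k = subset-↔ (λ {s} → IsIdeal-irrelevant {s = s}) ≡-irrelevant to from to∘from from∘to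
  where
  to : TH (suc k) → Onto k (suc k)
  to (s , ideal) = interiorDisks s ideal , onto⁺ (interiorDisks s ideal) (λ q →
    subst (0 <_) (sym (multᵛ-interiorDisks s ideal q)) (init-covers-pegs s ideal q))

  from : Onto k (suc k) → TH (suc k)
  from (v , o) = pegState v , pegState-ideal v (onto⁻ v o)

  to∘from : ∀ y → proj₁ (to (from y)) ≡ proj₁ y
  to∘from (v , o) = interiorDisks-pegState v (pegState-ideal v (onto⁻ v o))

  from∘to : ∀ x → proj₁ (from (to x)) ≡ proj₁ x
  from∘to (s , ideal) = trans (cong₂ _∷ʳ_ (map-peg-interiorDisks s ideal) (sym (last≡0 s ideal))) (init-∷ʳ-last s)

onto↔Lah : ∀ k → Onto k (suc k) ↔ Fin (suc k ! * k / 2)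
onto↔Lah k = subst (λ m → Onto k (suc k) ↔ Fin m) lah (onto↔surjections k (suc k))
  where
  lah : surjections k (suc k) ≡ suc k ! * k / 2
  lah = trans (sym (m*n/n≡m (surjections k (suc k)) 2)) (cong (_/ 2) (surjections-1+diag k))

theorem1 : (n : ℕ) → 1 ≤ n →
    (TH n ↔ PF n) ×
    (TH n ↔ Fin ((n !) * (n ∸ 1) / 2)) ×
    (PF n ↔ Fin ((n !) * (n ∸ 1) / 2))
theorem1 (suc k) _ =
  ↔-trans (ideal↔onto k) (↔-sym (pf↔onto k)) ,
  ↔-trans (ideal↔onto k) (onto↔Lah k) ,
  ↔-trans (pf↔onto k) (onto↔Lah k)
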